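{- The class of split graphs is degree sandwich monotone; that is, for every split graph $G$ and every set $F\subseteq E(G)$ such that $G-F$ is a split graph, every degree-minimal edge $e$ in $F$ satisfies that $G-e$ is a split graph.
   Context: A split graph is a graph whose vertex set can be partitioned into a clique and an independent set. For a graph $G$ and $F\subseteq E(G)$, an edge $uv\in F$ is degree-minimal in $F$ if (i) $u$ has the smallest degree in $G$ among all vertices incident to an edge of $F$, and (ii) $d_G(v)$ is smallest among all vertices $w$ with $uw\in F$. -}

module Defs where

open import Data.Nat using (ℕ; _≤_)
open import Data.Bool using (Bool; true; false; _∧_; _∨_; not; if_then_else_)
open import Data.Fin using (Fin; _≟_)
open import Data.List using (List; map; allFin)
open import Data.Nat.ListAction using (sum)
open import Data.Product using (Σ; _×_)
open import Relation.Binary.PropositionalEquality using (_≡_; _≢_)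
open import Relation.Nullary.Decidable using (⌊_⌋)

-- A (possibly non-simple) graph on vertex set Fin n, given by a Boolean
-- adjacency relation; edge sets F ⊆ E(G) are given the same way.
Rel₂ : ℕ → Set
Rel₂ n = Fin n → Fin n → Bool

IsSimpleGraph : ∀ {n} → Rel₂ n → Set
IsSimpleGraph {n} G = (∀ (x y : Fin n) → G x y ≡ G y x) × (∀ (x : Fin n) → G x x ≡ false)

IsEdgeSubset : ∀ {n} → Rel₂ n → Rel₂ n → Set
IsEdgeSubset {n} G F = (∀ (x y : Fin n) → F x y ≡ F y x) × (∀ (x y : Fin n) → F x y ≡ true → G x y ≡ true)

_minus_ : ∀ {n} → Rel₂ n → Rel₂ n → Rel₂ n
(G minus F) x y = G x y ∧ not (F x y)

singleEdge : ∀ {n} → Fin n → Fin n → Rel₂ n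
singleEdge u v x y = (⌊ x ≟ u ⌋ ∧ ⌊ y ≟ v ⌋) ∨ (⌊ x ≟ v ⌋ ∧ ⌊ y ≟ u ⌋)

_minusEdge_ : ∀ {n} → Rel₂ n → Fin n × Fin n → Rel₂ n
G minusEdge (u Data.Product., v) = G minus singleEdge u v

degree : ∀ {n} → Rel₂ n → Fin n → ℕ
degree {n} G v = sum (map (λ w → if G v w then 1 else 0) (allFin n))

IsSplit : ∀ {n} → Rel₂ n → Set
IsSplit {n} G = Σ (Fin n → Bool) λ K →
  (∀ (x y : Fin n) → x ≢ y → K x ≡ true → K y ≡ true → G x y ≡ true) ×
  (∀ (x y : Fin n) → K x ≡ false → K y ≡ false → G x y ≡ false)

DegreeMinimal : ∀ {n} → Rel₂ n → Rel₂ n → Fin n → Fin n → Set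
DegreeMinimal {n} G F u v =
  (F u v ≡ true) ×
  (∀ (x y : Fin n) → F x y ≡ true → degree G u ≤ degree G x) ×
  (∀ (w : Fin n) → F u w ≡ true → degree G v ≤ degree G w)

-- Let (K, I) and (K′, I′) be split partitions of G and G − F. If an endpoint of uv lies
-- in I, then (K, I) still splits G − uv. Otherwise u, v ∈ K, and it suffices to move an
-- endpoint w to the independent side, possibly moving its unique neighbour in I into the
-- clique. Degrees are tied to |K|: d(c) ≤ |K| for c ∈ I, with equality only if c is
-- complete to K, while d(w) ≥ |K| for w ∈ K with a neighbour in I, with equality only if
-- that neighbour is unique. Every vertex c incident to F has d(c) ≥ d(u), so once u has a
-- neighbour in I, any c ∈ I incident to F is squeezed by |K| ≤ d(u) ≤ d(c) ≤ |K| and can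
-- be exchanged with u. Some endpoint w lies in I′ since uv ∉ G − F, and every edge of G
-- inside I′ lies in F. So either such a c turns up, or the neighbours of w in I lie in K′,
-- where I has at most one vertex x; then x is exchanged with w unless x misses some y ∈ K,
-- in which case y ∈ I′, d(y) ≥ d(u) forces y to have a neighbour in I, and that neighbour
-- is in I′ and incident to F. Only condition (i) of degree-minimality is used.

module Submission where

open import Defs
open import Data.Nat using (ℕ; zero; suc; _+_; _≤_; _<_; s≤s; z≤n)
open import Data.Nat.Properties
  using (≤-refl; ≤-reflexive; ≤-trans; ≤-pred; <⇒≱; +-mono-≤; +-mono-≤-<; m≤n+m; +-suc;
         module ≤-Reasoning)
open import Data.Bool using (Bool; true; false; _∧_; _∨_; not; if_then_else_)
open import Data.Bool.Properties
  using (∧-conicalˡ; ∧-conicalʳ; ∧-zeroʳ; ∨-zeroʳ; ∨-identityʳ; ¬-not; not-¬; not-injective)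
  renaming (_≟_ to _≟ᵇ_)
open import Data.Fin using (Fin; zero; suc; _≟_)
open import Data.Fin.Properties using (any?)
open import Data.List using (map; allFin)
open import Data.List.Properties using (map-tabulate)
open import Data.Nat.ListAction using (sum)
open import Data.Product using (Σ; module Σ; ∃; _×_; _,_)
open import Data.Sum using (_⊎_; inj₁; inj₂; [_,_]′)
open import Data.Empty using (⊥-elim)
open import Function using (id; _∘_)
open import Relation.Nullary using (¬_; Dec; does; yes; no; ¬?)
open import Relation.Nullary.Decidable using (_×-dec_; dec-true; dec-false)
open import Relation.Binary.PropositionalEquality using (_≡_; _≢_; refl; sym; trans; cong; cong₂)

private
  variable
    n : ℕ

indicator : Bool → ℕ
indicator b = if b then 1 else 0

count : (Fin n → Bool) → ℕ
count {n} P = sum (map (indicator ∘ P) (allFin n))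

infix 4 _⊆_
infixr 6 _∪_
infixl 7 _-_

_⊆_ : (Fin n → Bool) → (Fin n → Bool) → Set
P ⊆ Q = ∀ z → P z ≡ true → Q z ≡ true

-- Using does rather than ⌊_⌋ makes ⁅ suc a ⁆ (suc z) reduce to ⁅ a ⁆ z.
⁅_⁆ : Fin n → Fin n → Bool
⁅ a ⁆ z = does (z ≟ a)

_∪_ : (Fin n → Bool) → (Fin n → Bool) → Fin n → Bool
(P ∪ Q) z = P z ∨ Q z

_-_ : (Fin n → Bool) → Fin n → Fin n → Bool
(P - w) z = not (does (z ≟ w)) ∧ P z

count-suc : (P : Fin (suc n) → Bool) → count P ≡ indicator (P zero) + count (P ∘ suc)
count-suc {n} P = cong (indicator (P zero) +_) (cong sum
  (trans (map-tabulate suc (indicator ∘ P)) (sym (map-tabulate id (indicator ∘ P ∘ suc)))))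

indicator-mono : {a b : Bool} → (a ≡ true → b ≡ true) → indicator a ≤ indicator b
indicator-mono {false} _ = z≤n
indicator-mono {true} a⇒b with refl ← a⇒b refl = ≤-refl

indicator≤1 : (b : Bool) → indicator b ≤ 1
indicator≤1 false = z≤n
indicator≤1 true = ≤-refl

count-mono : {P Q : Fin n → Bool} → P ⊆ Q → count P ≤ count Q
count-mono {zero} _ = z≤n
count-mono {suc n} {P} {Q} P⊆Q rewrite count-suc P | count-suc Q =
  +-mono-≤ (indicator-mono (P⊆Q zero)) (count-mono (P⊆Q ∘ suc))

count-mono-< : {P Q : Fin n → Bool} {z : Fin n} →
  P ⊆ Q → P z ≡ false → Q z ≡ true → count P < count Q
count-mono-< {suc n} {P} {Q} {zero} P⊆Q Pz Qz rewrite count-suc P | count-suc Q | Pz | Qz =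
  s≤s (count-mono (P⊆Q ∘ suc))
count-mono-< {suc n} {P} {Q} {suc z} P⊆Q Pz Qz rewrite count-suc P | count-suc Q =
  +-mono-≤-< (indicator-mono (P⊆Q zero)) (count-mono-< (P⊆Q ∘ suc) Pz Qz)

count-≤-suc : {P Q : Fin n → Bool} {z : Fin n} → P ⊆ ⁅ z ⁆ ∪ Q → count P ≤ suc (count Q)
count-≤-suc {suc n} {P} {Q} {zero} P⊆ rewrite count-suc P | count-suc Q =
  ≤-trans (+-mono-≤ (indicator≤1 (P zero)) (count-mono (P⊆ ∘ suc))) (s≤s (m≤n+m _ _))
count-≤-suc {suc n} {P} {Q} {suc z} P⊆ rewrite count-suc P | count-suc Q =
  ≤-trans (+-mono-≤ (indicator-mono (P⊆ zero)) (count-≤-suc (P⊆ ∘ suc)))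
          (≤-reflexive (+-suc _ _))

⊆-insert : {P : Fin n → Bool} (a : Fin n) → P ⊆ ⁅ a ⁆ ∪ P
⊆-insert {P = P} a z Pz rewrite Pz = ∨-zeroʳ (⁅ a ⁆ z)

insert-⊆ : {P Q : Fin n → Bool} {a : Fin n} → Q a ≡ true → P ⊆ Q → ⁅ a ⁆ ∪ P ⊆ Q
insert-⊆ {a = a} Qa P⊆Q z _ with z ≟ a
insert-⊆ Qa P⊆Q z _ | yes refl = Qa
insert-⊆ Qa P⊆Q z Pz | no _ = P⊆Q z Pz

count-insert : {P : Fin n → Bool} {a : Fin n} → P a ≡ false → count P < count (⁅ a ⁆ ∪ P)
count-insert {a = a} Pa = count-mono-< (⊆-insert a) Pa (cong (_∨ _) (dec-true (a ≟ a) refl))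

IsSplitPartition : Rel₂ n → (Fin n → Bool) → Set
IsSplitPartition {n} G K =
  (∀ (x y : Fin n) → x ≢ y → K x ≡ true → K y ≡ true → G x y ≡ true) ×
  (∀ (x y : Fin n) → K x ≡ false → K y ≡ false → G x y ≡ false)

minus-isSplitPartition : {G F : Rel₂ n} {K : Fin n → Bool} → IsSplitPartition G K →
  (∀ x y → K x ≡ true → K y ≡ true → F x y ≡ false) → IsSplitPartition (G minus F) K
minus-isSplitPartition (clique , independent) F-outside =
  (λ x y x≢y Kx Ky → cong₂ (λ g f → g ∧ not f) (clique x y x≢y Kx Ky) (F-outside x y Kx Ky)) ,
  (λ x y Kx Ky → cong (_∧ _) (independent x y Kx Ky))

singleEdge-avoiding : {u v w x y : Fin n} → w ≡ u ⊎ w ≡ v → x ≢ w → y ≢ w →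
  singleEdge u v x y ≡ false
singleEdge-avoiding {u = u} {x = x} {y} (inj₁ refl) x≢u y≢u with x ≟ u | y ≟ u
... | yes x≡u | _ = ⊥-elim (x≢u x≡u)
... | no _ | yes y≡u = ⊥-elim (y≢u y≡u)
... | no _ | no _ = ∧-zeroʳ _
singleEdge-avoiding {u = u} {v} {x = x} {y} (inj₂ refl) x≢v y≢v with x ≟ v | y ≟ v
... | yes x≡v | _ = ⊥-elim (x≢v x≡v)
... | no _ | yes y≡v = ⊥-elim (y≢v y≡v)
... | no _ | no _ = trans (∨-identityʳ _) (∧-zeroʳ _)

minusEdge-isSplit : {G : Rel₂ n} {K : Fin n → Bool} {u v w : Fin n} →
  IsSplitPartition G K → w ≡ u ⊎ w ≡ v → K w ≡ false → IsSplit (G minusEdge (u , v))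
minusEdge-isSplit {n} {K = K} {w = w} split w∈uv Kw =
  K , minus-isSplitPartition split λ x y Kx Ky → singleEdge-avoiding w∈uv (≢w Kx) (≢w Ky)
  where
  ≢w : {z : Fin n} → K z ≡ true → z ≢ w
  ≢w Kz refl = not-¬ Kz Kw

remove-self : (K : Fin n → Bool) (w : Fin n) → (K - w) w ≡ false
remove-self K w rewrite dec-true (w ≟ w) refl = refl

minusEdge-isSplit-removing : {G : Rel₂ n} {K : Fin n → Bool} {u v w : Fin n} →
  IsSplitPartition G (K - w) → w ≡ u ⊎ w ≡ v → IsSplit (G minusEdge (u , v))
minusEdge-isSplit-removing {K = K} {w = w} split w∈uv =
  minusEdge-isSplit split w∈uv (remove-self K w)

module Rearrange {G : Rel₂ n}
  (symmetric : ∀ x y → G x y ≡ G y x) (irreflexive : ∀ x → G x x ≡ false) where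

  insert-complete : {K : Fin n → Bool} {a : Fin n} → IsSplitPartition G K →
    (∀ z → K z ≡ true → G a z ≡ true) → IsSplitPartition G (⁅ a ⁆ ∪ K)
  insert-complete {K} {a} (clique , independent) a-complete = clique′ , independent′
    where
    clique′ : ∀ x y → x ≢ y → (⁅ a ⁆ ∪ K) x ≡ true → (⁅ a ⁆ ∪ K) y ≡ true → G x y ≡ true
    clique′ x y x≢y Kx Ky with x ≟ a | y ≟ a
    ... | yes refl | yes refl = ⊥-elim (x≢y refl)
    ... | yes refl | no _ = a-complete y Ky
    ... | no _ | yes refl = trans (symmetric x a) (a-complete x Kx)
    ... | no _ | no _ = clique x y x≢y Kx Ky
    independent′ : ∀ x y → (⁅ a ⁆ ∪ K) x ≡ false → (⁅ a ⁆ ∪ K) y ≡ false → G x y ≡ false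
    independent′ x y Kx Ky with x ≟ a | y ≟ a
    independent′ x y () Ky | yes _ | _
    independent′ x y Kx () | no _ | yes _
    ... | no _ | no _ = independent x y Kx Ky

  remove-vertex : {K : Fin n → Bool} {w : Fin n} → IsSplitPartition G K →
    (∀ b → K b ≡ false → G w b ≡ false) → IsSplitPartition G (K - w)
  remove-vertex {K} {w} (clique , independent) w-inside = clique′ , independent′
    where
    clique′ : ∀ x y → x ≢ y → (K - w) x ≡ true → (K - w) y ≡ true → G x y ≡ true
    clique′ x y x≢y Kx Ky with x ≟ w | y ≟ w
    clique′ x y x≢y () Ky | yes _ | _
    clique′ x y x≢y Kx () | no _ | yes _
    ... | no _ | no _ = clique x y x≢y Kx Ky
    independent′ : ∀ x y → (K - w) x ≡ false → (K - w) y ≡ false → G x y ≡ false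
    independent′ x y Kx Ky with x ≟ w | y ≟ w
    ... | yes refl | yes refl = irreflexive w
    ... | yes refl | no _ = w-inside y Ky
    ... | no _ | yes refl = trans (symmetric x w) (w-inside x Kx)
    ... | no _ | no _ = independent x y Kx Ky

  exchange : {K : Fin n → Bool} {a w : Fin n} → IsSplitPartition G K →
    (∀ z → K z ≡ true → G a z ≡ true) → (∀ b → K b ≡ false → G w b ≡ true → b ≡ a) →
    IsSplitPartition G ((⁅ a ⁆ ∪ K) - w)
  exchange {K} {a} {w} split a-complete w-unique =
    remove-vertex (insert-complete split a-complete) w-inside
    where
    w-inside : ∀ b → (⁅ a ⁆ ∪ K) b ≡ false → G w b ≡ false
    w-inside b b-outside with b ≟ a | G w b in Gwb
    w-inside b () | yes _ | _
    ... | no b≢a | true = ⊥-elim (b≢a (w-unique b b-outside Gwb))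
    ... | no _ | false = refl

module SplitDegrees {G : Rel₂ n} (irreflexive : ∀ x → G x x ≡ false)
  {K : Fin n → Bool} (split : IsSplitPartition G K) where

  open Σ split renaming (proj₁ to clique; proj₂ to independent)

  OutsideNeighbour : Fin n → Set
  OutsideNeighbour w = ∃ λ b → K b ≡ false × G w b ≡ true

  outsideNeighbour? : ∀ w → Dec (OutsideNeighbour w)
  outsideNeighbour? w = any? λ b → K b ≟ᵇ false ×-dec G w b ≟ᵇ true

  no-outside-neighbour : {w : Fin n} → ¬ OutsideNeighbour w → ∀ b → K b ≡ false → G w b ≡ false
  no-outside-neighbour none b Kb = ¬-not λ Gwb → none (b , Kb , Gwb)

  neighbours-of-outside⊆K : {c : Fin n} → K c ≡ false → G c ⊆ K
  neighbours-of-outside⊆K {c} Kc z Gcz with K z in Kz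
  ... | true = refl
  ... | false = ⊥-elim (not-¬ Gcz (independent c z Kc Kz))

  degree-outside≤count : {c : Fin n} → K c ≡ false → degree G c ≤ count K
  degree-outside≤count Kc = count-mono (neighbours-of-outside⊆K Kc)

  complete-of-count≤degree : {c : Fin n} → K c ≡ false → count K ≤ degree G c →
    ∀ z → K z ≡ true → G c z ≡ true
  complete-of-count≤degree {c} Kc K≤c z Kz with G c z in Gcz
  ... | true = refl
  ... | false = ⊥-elim (<⇒≱ (count-mono-< (neighbours-of-outside⊆K Kc) Gcz Kz) K≤c)

  degree<count-of-no-outside-neighbour : {y : Fin n} → K y ≡ true →
    (∀ b → K b ≡ false → G y b ≡ false) → degree G y < count K
  degree<count-of-no-outside-neighbour {y} Ky none = count-mono-< neighbours⊆K (irreflexive y) Ky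
    where
    neighbours⊆K : G y ⊆ K
    neighbours⊆K z Gyz with K z in Kz
    ... | true = refl
    ... | false = ⊥-elim (not-¬ Gyz (none z Kz))

  closed-neighbourhood-inside : {w : Fin n} → K w ≡ true → K ⊆ ⁅ w ⁆ ∪ G w
  closed-neighbourhood-inside {w} Kw z Kz with z ≟ w
  ... | yes _ = refl
  ... | no z≢w = clique w z (z≢w ∘ sym) Kw Kz

  count≤degree-of-outside-neighbour : {w a : Fin n} → K w ≡ true → K a ≡ false → G w a ≡ true →
    count K ≤ degree G w
  count≤degree-of-outside-neighbour {w} {a} Kw Ka Gwa = ≤-pred (begin
    suc (count K)             ≤⟨ count-insert {P = K} Ka ⟩
    count (⁅ a ⁆ ∪ K)         ≤⟨ count-≤-suc (insert-⊆ (⊆-insert {P = G w} w a Gwa)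
                                                      (closed-neighbourhood-inside Kw)) ⟩
    suc (degree G w)          ∎)
    where open ≤-Reasoning

  outside-neighbour-unique : {w a b : Fin n} → K w ≡ true → degree G w ≤ count K →
    K a ≡ false → K b ≡ false → G w a ≡ true → G w b ≡ true → b ≡ a
  outside-neighbour-unique {w} {a} {b} Kw w≤K Ka Kb Gwa Gwb with b ≟ a
  ... | yes b≡a = b≡a
  ... | no b≢a = ⊥-elim (<⇒≱ K<w w≤K)
    where
    open ≤-Reasoning
    a∪K∌b : (⁅ a ⁆ ∪ K) b ≡ false
    a∪K∌b = trans (cong (_∨ K b) (dec-false (b ≟ a) b≢a)) Kb
    K<w : count K < degree G w
    K<w = ≤-pred (begin
      suc (suc (count K))          ≤⟨ s≤s (count-insert {P = K} Ka) ⟩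
      suc (count (⁅ a ⁆ ∪ K))      ≤⟨ count-insert {P = ⁅ a ⁆ ∪ K} a∪K∌b ⟩
      count (⁅ b ⁆ ∪ ⁅ a ⁆ ∪ K)    ≤⟨ count-≤-suc (insert-⊆ (⊆-insert {P = G w} w b Gwb)
                                        (insert-⊆ (⊆-insert {P = G w} w a Gwa)
                                                  (closed-neighbourhood-inside Kw))) ⟩
      suc (degree G w)             ∎)

module DegreeMinimalEdge {G F : Rel₂ n}
  (symmetric : ∀ x y → G x y ≡ G y x) (irreflexive : ∀ x → G x x ≡ false)
  {K : Fin n → Bool} (split : IsSplitPartition G K)
  (F-edges : IsEdgeSubset G F)
  {K′ : Fin n → Bool} (split′ : IsSplitPartition (G minus F) K′)
  {u v : Fin n} (Fuv : F u v ≡ true)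
  (u-minimal : ∀ x y → F x y ≡ true → degree G u ≤ degree G x)
  where

  open Σ split renaming (proj₁ to clique; proj₂ to independent)
  open Σ split′ renaming (proj₁ to clique′; proj₂ to independent′)
  open Σ F-edges renaming (proj₁ to F-symmetric; proj₂ to F⊆G)
  open Rearrange symmetric irreflexive
  open SplitDegrees irreflexive split

  H : Rel₂ n
  H = G minusEdge (u , v)

  F-degree : {x y : Fin n} → F x y ≡ true → degree G u ≤ degree G y
  F-degree {x} {y} Fxy = u-minimal y x (trans (F-symmetric y x) Fxy)

  outside′-edge∈F : {x y : Fin n} → K′ x ≡ false → K′ y ≡ false → G x y ≡ true → F x y ≡ true
  outside′-edge∈F {x} {y} K′x K′y Gxy =
    not-injective (trans (cong (_∧ not (F x y)) (sym Gxy)) (independent′ x y K′x K′y))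

  clique′-edge∈G : {x y : Fin n} → x ≢ y → K′ x ≡ true → K′ y ≡ true → G x y ≡ true
  clique′-edge∈G {x} {y} x≢y K′x K′y = ∧-conicalˡ _ _ (clique′ x y x≢y K′x K′y)

  outside-inside′-unique : {x y : Fin n} →
    K x ≡ false → K y ≡ false → K′ x ≡ true → K′ y ≡ true → x ≡ y
  outside-inside′-unique {x} {y} Kx Ky K′x K′y with x ≟ y
  ... | yes x≡y = x≡y
  ... | no x≢y = ⊥-elim (not-¬ (clique′-edge∈G x≢y K′x K′y) (independent x y Kx Ky))

  endpoint-outside′ : K′ u ≡ false ⊎ K′ v ≡ false
  endpoint-outside′ with K′ u in K′u | K′ v in K′v
  ... | false | _ = inj₁ refl
  ... | true | false = inj₂ refl
  ... | true | true = ⊥-elim (not-¬ (∧-conicalʳ _ _ (clique′ u v u≢v K′u K′v)) (cong not Fuv))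
    where
    u≢v : u ≢ v
    u≢v refl = not-¬ (F⊆G u u Fuv) (irreflexive u)

  remove-endpoint : {w : Fin n} → w ≡ u ⊎ w ≡ v → ¬ OutsideNeighbour w → IsSplit H
  remove-endpoint w∈uv none =
    minusEdge-isSplit-removing (remove-vertex split (no-outside-neighbour none)) w∈uv

  exchange-endpoint : {w a : Fin n} → w ≡ u ⊎ w ≡ v → (∀ z → K z ≡ true → G a z ≡ true) →
    (∀ b → K b ≡ false → G w b ≡ true → b ≡ a) → IsSplit H
  exchange-endpoint w∈uv a-complete w-unique =
    minusEdge-isSplit-removing (exchange split a-complete w-unique) w∈uv

  module _ (Ku : K u ≡ true) {a : Fin n} (Ka : K a ≡ false) (Gua : G u a ≡ true) where

    K≤u : count K ≤ degree G u
    K≤u = count≤degree-of-outside-neighbour Ku Ka Gua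

    exchange-u-with : {c : Fin n} → K c ≡ false → degree G u ≤ degree G c → IsSplit H
    exchange-u-with {c} Kc u≤c = exchange-endpoint (inj₁ refl) c-complete u-unique
      where
      c-complete : ∀ z → K z ≡ true → G c z ≡ true
      c-complete = complete-of-count≤degree Kc (≤-trans K≤u u≤c)
      u-unique : ∀ b → K b ≡ false → G u b ≡ true → b ≡ c
      u-unique b Kb Gub = outside-neighbour-unique Ku (≤-trans u≤c (degree-outside≤count Kc))
        Kc Kb (trans (symmetric u c) (c-complete u Ku)) Gub

    outside-neighbour-of-degree≥u : {y : Fin n} → K y ≡ true → degree G u ≤ degree G y →
      OutsideNeighbour y
    outside-neighbour-of-degree≥u {y} Ky u≤y with outsideNeighbour? y
    ... | yes found = found
    ... | no none =
      ⊥-elim (<⇒≱ (degree<count-of-no-outside-neighbour Ky (no-outside-neighbour none))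
                  (≤-trans K≤u u≤y))

    split-if-misses-clique-vertex : {w x y : Fin n} → K w ≡ true → K′ w ≡ false →
      K x ≡ false → K′ x ≡ true → K y ≡ true → y ≢ w → G x y ≡ false → IsSplit H
    split-if-misses-clique-vertex {w} {x} {y} Kw K′w Kx K′x Ky y≢w Gxy =
      resolve (outside-neighbour-of-degree≥u Ky u≤y)
      where
      K′y : K′ y ≡ false
      K′y = ¬-not λ K′y → not-¬ (clique′-edge∈G (λ { refl → not-¬ Ky Kx }) K′x K′y) Gxy
      u≤y : degree G u ≤ degree G y
      u≤y = F-degree (outside′-edge∈F K′w K′y (clique w y (y≢w ∘ sym) Kw Ky))
      resolve : OutsideNeighbour y → IsSplit H
      resolve (c , Kc , Gyc) with K′ c in K′c
      ... | false = exchange-u-with Kc (F-degree (outside′-edge∈F K′y K′c Gyc))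
      ... | true with refl ← outside-inside′-unique Kc Kx K′c K′x =
        ⊥-elim (not-¬ (trans (symmetric x y) Gyc) Gxy)

    split-from-endpoint-with-neighbours-inside′ : {w : Fin n} → w ≡ u ⊎ w ≡ v →
      K w ≡ true → K′ w ≡ false → (∀ b → K b ≡ false → G w b ≡ true → K′ b ≡ true) → IsSplit H
    split-from-endpoint-with-neighbours-inside′ {w} w∈uv Kw K′w inside′ with outsideNeighbour? w
    ... | no none = remove-endpoint w∈uv none
    ... | yes (x , Kx , Gwx)
      with any? (λ y → K y ≟ᵇ true ×-dec ¬? (y ≟ w) ×-dec G x y ≟ᵇ false)
    ...   | yes (y , Ky , y≢w , Gxy) =
      split-if-misses-clique-vertex Kw K′w Kx (inside′ x Kx Gwx) Ky y≢w Gxy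
    ...   | no none = exchange-endpoint w∈uv x-complete w-unique
      where
      x-complete : ∀ z → K z ≡ true → G x z ≡ true
      x-complete z Kz with z ≟ w
      ... | yes refl = trans (symmetric x z) Gwx
      ... | no z≢w = ¬-not λ Gxz → none (z , Kz , z≢w , Gxz)
      w-unique : ∀ b → K b ≡ false → G w b ≡ true → b ≡ x
      w-unique b Kb Gwb = outside-inside′-unique Kb Kx (inside′ b Kb Gwb) (inside′ x Kx Gwx)

    split-from-outside′-endpoint : {w : Fin n} → w ≡ u ⊎ w ≡ v → K w ≡ true → K′ w ≡ false →
      IsSplit H
    split-from-outside′-endpoint {w} w∈uv Kw K′w
      with any? (λ b → K b ≟ᵇ false ×-dec G w b ≟ᵇ true ×-dec K′ b ≟ᵇ false)
    ... | yes (b , Kb , Gwb , K′b) = exchange-u-with Kb (F-degree (outside′-edge∈F K′w K′b Gwb))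
    ... | no none = split-from-endpoint-with-neighbours-inside′ w∈uv Kw K′w
                      λ b Kb Gwb → ¬-not λ K′b → none (b , Kb , Gwb , K′b)

  split-if-endpoints-inside : K u ≡ true → K v ≡ true → IsSplit H
  split-if-endpoints-inside Ku Kv with outsideNeighbour? u
  ... | no none = remove-endpoint (inj₁ refl) none
  ... | yes (a , Ka , Gua) =
    [ split-from-outside′-endpoint Ku Ka Gua (inj₁ refl) Ku
    , split-from-outside′-endpoint Ku Ka Gua (inj₂ refl) Kv
    ]′ endpoint-outside′

theorem4p1 : (n : ℕ) (G F : Rel₂ n) → IsSimpleGraph G → IsSplit G
    → IsEdgeSubset G F → IsSplit (G minus F)
    → (u v : Fin n) → DegreeMinimal G F u v
    → IsSplit (G minusEdge (u , v))
theorem4p1 n G F (symmetric , irreflexive) (K , split) F-edges (K′ , split′) u v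
  (Fuv , u-minimal , _) with K u in Ku | K v in Kv
... | false | _ = minusEdge-isSplit split (inj₁ refl) Ku
... | true | false = minusEdge-isSplit split (inj₂ refl) Kv
... | true | true =
  DegreeMinimalEdge.split-if-endpoints-inside symmetric irreflexive split F-edges split′ Fuv u-minimal
    Ku Kv
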